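{- Let $p\le q$ be $n$-symmetric lattice paths. Then $\dim P(\Delta[p,q])=n-k+1$, where $k$ is the number of lattice points lying on both $p$ and $q$ that are weakly above the line $y=n-x$.
   Context: An $n$-symmetric lattice path is a path from $(0,0)$ to $(n,n)$ of $2n$ unit steps $E=(1,0)$, $N=(0,1)$, a word $\alpha_1\cdots\alpha_{2n}$ with $\alpha_i\ne\alpha_{2n-i+1}$ for $i\le n$; $p\le q$ means $p$ lies weakly below $q$. $\operatorname{lab}^L(r)$: label steps in order by $-n,\dots,-1,1,\dots,n$ and record the labels of $E$ steps. $\Delta[p,q]$ is the delta matroid on $[n]$ with feasible sets $\operatorname{lab}^L(r)\cap[n]$ for symmetric $r$ with $p\le r\le q$, and $P(\Delta[p,q])\subseteq\mathbb{R}^n$ is the convex hull of their indicator vectors. -}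

module Defs where

open import Data.Nat using (ℕ; zero; suc; _≤_; _<_; _<?_; _≤?_; _∸_)
open import Data.Nat.Properties using () renaming (_≟_ to _≟ℕ_)
open import Data.Integer as ℤ using (ℤ; +_; _-_)
open import Data.Rational using (ℚ; 0ℚ; 1ℚ) renaming (_+_ to _+ℚ_; _*_ to _*ℚ_)
open import Data.Fin using (Fin; toℕ; opposite; _↑ʳ_)
open import Data.Bool using (Bool; true; false; if_then_else_)
open import Data.Vec using (Vec; lookup; toList)
open import Data.List using (List; []; _∷_; length; take; map; filter; upTo)
open import Data.List.Membership.Propositional using (_∈_)
open import Data.List.Membership.DecPropositional ℤ._≟_ using (_∈?_)
open import Data.Product using (Σ; ∃; _×_; _,_)
open import Data.Product.Properties using (≡-dec)
open import Relation.Binary.PropositionalEquality using (_≡_; _≢_)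
open import Relation.Nullary using (¬_; Dec; yes; no; does)
open import Relation.Nullary.Decidable using (⌊_⌋; _×-dec_)

-- Unit steps E = (1,0) and N = (0,1).
data Step : Set where
  E N : Step

count : Step → List Step → ℕ
count s [] = 0
count E (E ∷ w) = suc (count E w)
count E (N ∷ w) = count E w
count N (N ∷ w) = suc (count N w)
count N (E ∷ w) = count N w

record LatticePath (n : ℕ) : Set where
  constructor mkPath
  field
    word   : Vec Step (n Data.Nat.+ n)
    #E≡n   : count E (toList word) ≡ n
    #N≡n   : count N (toList word) ≡ n
open LatticePath public

-- n-symmetric: α_i ≠ α_{2n-i+1} for i ≤ n (0-indexed: positions i and 2n-1-i, i < n).
Symmetric : {n : ℕ} → LatticePath n → Set
Symmetric {n} p = (i : Fin (n Data.Nat.+ n)) → toℕ i < n →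
  lookup (word p) i ≢ lookup (word p) (opposite i)

point : {n : ℕ} → LatticePath n → ℕ → ℕ × ℕ
point p k = count E (take k (toList (word p))) , count N (take k (toList (word p)))

_≼_ : {n : ℕ} → LatticePath n → LatticePath n → Set
_≼_ {n} p q = (k : ℕ) → k ≤ n Data.Nat.+ n →
  count N (take k (toList (word p))) ≤ count N (take k (toList (word q)))

-- Labels of the steps, in order: -n, ..., -1, 1, ..., n.
label : {n : ℕ} → Fin (n Data.Nat.+ n) → ℤ
label {n} i with toℕ i <? n
... | yes _ = (+ toℕ i) - (+ n)
... | no  _ = ((+ toℕ i) - (+ n)) ℤ.+ (+ 1)

allPositions : (m : ℕ) → List (Fin m)
allPositions m = Data.List.allFin m

labL : {n : ℕ} → LatticePath n → List ℤ
labL {n} r = map (label {n}) (filter (λ i → isE (lookup (word r) i)) (allPositions (n Data.Nat.+ n)))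
  where
  isE : (s : Step) → Dec (s ≡ E)
  isE E = yes _≡_.refl
  isE N = no (λ ())

-- Indicator vector (in ℚ^n) of lab^L(r) ∩ [n]; coordinate j : Fin n stands for j+1 ∈ [n].
indicator : {n : ℕ} → LatticePath n → Fin n → ℚ
indicator r j = if ⌊ (+ suc (toℕ j)) ∈? labL r ⌋ then 1ℚ else 0ℚ

-- The indicator vectors of the feasible sets of Δ[p,q].
FeasibleVector : {n : ℕ} → LatticePath n → LatticePath n → (Fin n → ℚ) → Set
FeasibleVector p q v = ∃ λ r → Symmetric r × p ≼ r × r ≼ q × ((j : _) → v j ≡ indicator r j)

Σ[_] : {m : ℕ} → (Fin m → ℚ) → ℚ
Σ[_] {zero} f = 0ℚ
Σ[_] {suc m} f = f Data.Fin.zero +ℚ Σ[_] (λ i → f (Data.Fin.suc i))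

AffinelyIndependent : {n m : ℕ} → (Fin m → Fin n → ℚ) → Set
AffinelyIndependent vs = (c : _ → ℚ) → Σ[ c ] ≡ 0ℚ →
  ((j : _) → Σ[ (λ i → c i *ℚ vs i j) ] ≡ 0ℚ) → (i : _) → c i ≡ 0ℚ

-- The dimension of the convex hull of a set S of points is d
-- (dim conv S = dim aff S = (max # affinely independent points of S) - 1).
ConvHullDim : {n : ℕ} → ((Fin n → ℚ) → Set) → ℕ → Set
ConvHullDim {n} S d =
  (∃ λ (vs : Fin (suc d) → Fin n → ℚ) → ((i : _) → S (vs i)) × AffinelyIndependent vs)
  × ((vs : Fin (suc (suc d)) → Fin n → ℚ) → ((i : _) → S (vs i)) → ¬ AffinelyIndependent vs)

-- k: number of lattice points common to p and q weakly above the line y = n - x.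
-- Such a point lies on a path at step index x + y ≥ n, so we count step indices
-- t ∈ {0,...,2n} with t ≥ n where p and q pass through the same lattice point.
commonAbove : {n : ℕ} → LatticePath n → LatticePath n → ℕ
commonAbove {n} p q = length (filter (λ t → (n ≤? t) ×-dec ≡-dec _≟ℕ_ _≟ℕ_ (point p t) (point q t))
                                    (upTo (suc (n Data.Nat.+ n))))

-- A symmetric path r is determined by its second half W = half r, and lab^L(r) ∩ [n] is the set of
-- positions of E-steps in W. Comparing heights of symmetric paths amounts to comparing, for every
-- suffix, the numbers of E-steps of the second halves, so the feasible vectors are the E-indicator
-- vectors of the words W with P ⊑ W ⊑ Q, where P and Q are the halves of p and q. Call a suffix
-- position tight when P and Q have equally many E-steps there, and loose otherwise. Every feasible
-- vector satisfies the equations of the tight positions, and eliminating one coordinate per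
-- position shows that these leave room for at most ℓ + 1 affinely independent points, ℓ the number
-- of loose positions; conversely an induction along the words, duplicating one word at each loose
-- position, produces ℓ + 1 of them. Finally the suffix of the halves starting at j corresponds to
-- the lattice point reached after n + j steps, which is where the path lies weakly above
-- y = n - x, and P and Q agree there exactly at the common points of p and q; so ℓ = n + 1 - k.

module Submission where

open import Defs
open import Level using (0ℓ)
open import Algebra.Bundles using (Ring)
open import Function using (_∘_)
open import Data.Empty using (⊥-elim)
open import Data.Unit using (⊤; tt)
open import Data.Product using (∃; ∃₂; _×_; _,_; proj₁; proj₂; swap)
open import Data.Product.Properties using (≡-dec)
open import Data.Nat using (ℕ; zero; suc; _+_; _∸_; _⊔_; _⊓_; _≤_; _<_; z≤n; s≤s; s≤s⁻¹; _≤?_; _<?_)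
import Data.Nat.Properties as ℕₚ
open import Data.Nat.Properties using () renaming (_≟_ to _≟ℕ_)
open import Data.Fin using (Fin; zero; suc; toℕ; fromℕ; fromℕ<; inject₁; punchIn; opposite; _↑ˡ_; _↑ʳ_)
import Data.Fin.Properties as Finₚ
import Data.Integer as ℤ
import Data.Integer.Properties as ℤₚ
open import Data.Rational using (ℚ; 0ℚ; 1ℚ; 1/_; -_; ≢-nonZero) renaming (_+_ to _+ℚ_; _*_ to _*ℚ_)
import Data.Rational.Properties as ℚₚ
open import Algebra.Properties.Semiring.Sum (Ring.semiring ℚₚ.+-*-ring)
  using (sum; sum-cong-≗; sum-replicate-zero; sum-remove; ∑-distrib-+; ∑-comm; *-distribˡ-sum; *-distribʳ-sum)
open import Algebra.Properties.Semiring.Mult (Ring.semiring ℚₚ.+-*-ring) using () renaming (_×_ to _·_)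
import Tactic.RingSolver.Core.AlmostCommutativeRing as ACR
open import Tactic.RingSolver using (solve-∀)
open import Data.Vec.Functional using (tail; insertAt)
open import Data.Vec.Functional.Properties using (insertAt-lookup; insertAt-punchIn)
open import Data.Vec using (Vec; []; _∷_; lookup; toList)
import Data.Vec as Vec
import Data.Vec.Properties as Vecₚ
import Data.List as List
open import Data.List using (List; []; _∷_; length; filter; applyUpTo; upTo)
import Data.List.Properties as Listₚ
open import Data.List.Membership.Propositional using (_∈_)
open import Data.List.Membership.Propositional.Properties using (∈-map⁻; ∈-map⁺; ∈-filter⁻; ∈-filter⁺; ∈-allFin)
open import Data.List.Membership.DecPropositional ℤ._≟_ using (_∈?_)
open import Relation.Binary.PropositionalEquality
open import Relation.Nullary using (¬_; yes; no)
open import Relation.Nullary.Decidable using (dec⇒maybe; _×-dec_)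
open import Relation.Unary using (Pred; Decidable)
open ≡-Reasoning

-- Linear algebra over ℚ

ℚ-ring : ACR.AlmostCommutativeRing 0ℓ 0ℓ
ℚ-ring = ACR.fromCommutativeRing ℚₚ.+-*-commutativeRing (λ x → dec⇒maybe (0ℚ ℚₚ.≟ x))

sum-zero : ∀ {k} {f : Fin k → ℚ} → (∀ i → f i ≡ 0ℚ) → sum f ≡ 0ℚ
sum-zero {k} f≗0 = trans (sum-cong-≗ f≗0) (sum-replicate-zero k)

Σ≡sum : ∀ {k} (f : Fin k → ℚ) → Σ[ f ] ≡ sum f
Σ≡sum {zero}  f = refl
Σ≡sum {suc k} f = cong (f zero +ℚ_) (Σ≡sum (f ∘ suc))

-- (x , vs) encodes the vectors (x i , vs i) ∈ ℚ × ℚᵐ; x is a homogenising coordinate.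
record Annihilates {k m} (c x : Fin k → ℚ) (vs : Fin k → Fin m → ℚ) : Set where
  constructor _,_
  field
    on-x  : sum (λ i → c i *ℚ x i) ≡ 0ℚ
    on-vs : ∀ j → sum (λ i → c i *ℚ vs i j) ≡ 0ℚ

Dependent : ∀ {k m} → (Fin k → ℚ) → (Fin k → Fin m → ℚ) → Set
Dependent x vs = ∃ λ c → Annihilates c x vs × ∃ λ i → c i ≢ 0ℚ

Independent : ∀ {k m} → (Fin k → ℚ) → (Fin k → Fin m → ℚ) → Set
Independent x vs = ∀ c → Annihilates c x vs → ∀ i → c i ≡ 0ℚ

dependent-≗ : ∀ {k m} {x : Fin k → ℚ} {vs ws : Fin k → Fin m → ℚ} →
  (∀ i j → vs i j ≡ ws i j) → Dependent x ws → Dependent x vs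
dependent-≗ vs≗ws (c , (cx≡0 , cws≡0) , nontrivial) =
  c , (cx≡0 , λ j → trans (sum-cong-≗ (λ i → cong (c i *ℚ_) (vs≗ws i j))) (cws≡0 j)) , nontrivial

dependent⇒¬affinelyIndependent : ∀ {k m} {vs : Fin k → Fin m → ℚ} →
  Dependent (λ _ → 1ℚ) vs → ¬ AffinelyIndependent vs
dependent⇒¬affinelyIndependent {vs = vs} (c , (c1≡0 , cvs≡0) , i , cᵢ≢0) affinelyIndependent = cᵢ≢0
  (affinelyIndependent c (trans (Σ≡sum c) (trans (sym (sum-cong-≗ (ℚₚ.*-identityʳ ∘ c))) c1≡0))
                         (λ j → trans (Σ≡sum (λ i → c i *ℚ vs i j)) (cvs≡0 j)) i)

independent⇒affinelyIndependent : ∀ {k m} (vs : Fin k → Fin m → ℚ) →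
  Independent (λ _ → 1ℚ) vs → AffinelyIndependent vs
independent⇒affinelyIndependent vs independent c Σc≡0 Σcvs≡0 = independent c
  ( trans (sum-cong-≗ (ℚₚ.*-identityʳ ∘ c)) (trans (sym (Σ≡sum c)) Σc≡0)
  , λ j → trans (sym (Σ≡sum (λ i → c i *ℚ vs i j))) (Σcvs≡0 j) )

sweep : ∀ {k} → Fin (suc k) → (Fin k → ℚ) → (Fin (suc k) → ℚ) → Fin k → ℚ
sweep p l f i = f (punchIn p i) +ℚ l i *ℚ f p

sweepColumns : ∀ {k m} → Fin (suc k) → (Fin k → ℚ) → (Fin (suc k) → Fin m → ℚ) → Fin k → Fin m → ℚ
sweepColumns p l vs i j = sweep p l (λ r → vs r j) i

sum-sweep : ∀ {k} p (l c : Fin k → ℚ) (f : Fin (suc k) → ℚ) →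
  sum (λ i → c i *ℚ sweep p l f i) ≡ sum (λ r → insertAt c p (sum (λ i → c i *ℚ l i)) r *ℚ f r)
sum-sweep p l c f = begin
  sum (λ i → c i *ℚ sweep p l f i)
    ≡⟨ sum-cong-≗ (λ i → distrib (c i) (f (punchIn p i)) (l i) (f p)) ⟩
  sum (λ i → c i *ℚ f (punchIn p i) +ℚ (c i *ℚ l i) *ℚ f p)
    ≡⟨ ∑-distrib-+ (λ i → c i *ℚ f (punchIn p i)) (λ i → (c i *ℚ l i) *ℚ f p) ⟩
  sum (λ i → c i *ℚ f (punchIn p i)) +ℚ sum (λ i → (c i *ℚ l i) *ℚ f p)
    ≡⟨ cong (sum (λ i → c i *ℚ f (punchIn p i)) +ℚ_) (sym (*-distribʳ-sum (f p) (λ i → c i *ℚ l i))) ⟩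
  sum (λ i → c i *ℚ f (punchIn p i)) +ℚ μ *ℚ f p
    ≡⟨ ℚₚ.+-comm _ (μ *ℚ f p) ⟩
  μ *ℚ f p +ℚ sum (λ i → c i *ℚ f (punchIn p i))
    ≡⟨ sym (cong₂ _+ℚ_ (cong (_*ℚ f p) (insertAt-lookup c p μ))
                       (sum-cong-≗ (λ i → cong (_*ℚ f (punchIn p i)) (insertAt-punchIn c p μ i)))) ⟩
  insertAt c p μ p *ℚ f p +ℚ sum (λ i → insertAt c p μ (punchIn p i) *ℚ f (punchIn p i))
    ≡⟨ sym (sum-remove {i = p} (λ r → insertAt c p μ r *ℚ f r)) ⟩
  sum (λ r → insertAt c p μ r *ℚ f r) ∎
  where
  μ = sum (λ i → c i *ℚ l i)
  distrib : ∀ c a l b → c *ℚ (a +ℚ l *ℚ b) ≡ c *ℚ a +ℚ (c *ℚ l) *ℚ b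
  distrib = solve-∀ ℚ-ring

dependent-sweep : ∀ {k m} p (l : Fin k → ℚ) (x : Fin (suc k) → ℚ) (vs : Fin (suc k) → Fin m → ℚ) →
  Dependent (sweep p l x) (sweepColumns p l vs) → Dependent x vs
dependent-sweep p l x vs (c , (cx≡0 , cvs≡0) , i , cᵢ≢0) =
  insertAt c p μ ,
  (trans (sym (sum-sweep p l c x)) cx≡0 , λ j → trans (sym (sum-sweep p l c (λ r → vs r j))) (cvs≡0 j)) ,
  punchIn p i , λ eq → cᵢ≢0 (trans (sym (insertAt-punchIn c p μ i)) eq)
  where μ = sum (λ i → c i *ℚ l i)

clearing-sweep : ∀ {k} (f : Fin (suc k) → ℚ) → ∃₂ λ p l → ∀ i → sweep p l f i ≡ 0ℚ
clearing-sweep f with Finₚ.all? (λ i → f i ℚₚ.≟ 0ℚ)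
... | yes f≗0 = zero , (λ _ → 0ℚ) , λ i →
  trans (cong₂ _+ℚ_ (f≗0 (suc i)) (ℚₚ.*-zeroˡ (f zero))) (ℚₚ.+-identityˡ 0ℚ)
... | no ¬f≗0 with Finₚ.¬∀⟶∃¬ _ _ (λ i → f i ℚₚ.≟ 0ℚ) ¬f≗0
...   | p , fₚ≢0 = p , (λ i → - (f (punchIn p i) *ℚ 1/ f p)) , λ i → cancel (f (punchIn p i))
  where
  instance _ = ≢-nonZero fₚ≢0
  cancel : ∀ a → a +ℚ - (a *ℚ 1/ f p) *ℚ f p ≡ 0ℚ
  cancel a = begin
    a +ℚ - (a *ℚ 1/ f p) *ℚ f p     ≡⟨ reassociate a (1/ f p) (f p) ⟩
    a +ℚ - (a *ℚ (1/ f p *ℚ f p))   ≡⟨ cong (λ z → a +ℚ - (a *ℚ z)) (ℚₚ.*-inverseˡ (f p)) ⟩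
    a +ℚ - (a *ℚ 1ℚ)               ≡⟨ annul a ⟩
    0ℚ ∎
    where
    reassociate : ∀ a b c → a +ℚ - (a *ℚ b) *ℚ c ≡ a +ℚ - (a *ℚ (b *ℚ c))
    reassociate = solve-∀ ℚ-ring
    annul : ∀ a → a +ℚ - (a *ℚ 1ℚ) ≡ 0ℚ
    annul = solve-∀ ℚ-ring

dependent-head-zero : ∀ {k m} {x : Fin k → ℚ} {vs : Fin k → Fin (suc m) → ℚ} →
  (∀ i → vs i zero ≡ 0ℚ) → Dependent x (tail ∘ vs) → Dependent x vs
dependent-head-zero vs₀≡0 (c , (cx≡0 , cvs≡0) , nontrivial) =
  c , (cx≡0 , λ { zero → sum-zero (λ i → trans (cong (c i *ℚ_) (vs₀≡0 i)) (ℚₚ.*-zeroʳ (c i)))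
                ; (suc j) → cvs≡0 j }) ,
  nontrivial

dependent-head-determined : ∀ {k m} α {x : Fin k → ℚ} {vs : Fin k → Fin (suc m) → ℚ} →
  (∀ i → sum (vs i) ≡ α *ℚ x i) → Dependent x (tail ∘ vs) → Dependent x vs
dependent-head-determined α {x} {vs} sumᵢ (c , (cx≡0 , cvs≡0) , nontrivial) =
  c , (cx≡0 , λ { zero → heads≡0 ; (suc j) → cvs≡0 j }) , nontrivial
  where
  heads = sum (λ i → c i *ℚ vs i zero)
  tails = sum (λ i → c i *ℚ sum (tail (vs i)))
  tails≡0 : tails ≡ 0ℚ
  tails≡0 = begin
    tails                                         ≡⟨ sum-cong-≗ (λ i → *-distribˡ-sum (c i) (tail (vs i))) ⟩
    sum (λ i → sum (λ j → c i *ℚ vs i (suc j)))   ≡⟨ ∑-comm (λ i j → c i *ℚ vs i (suc j)) ⟩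
    sum (λ j → sum (λ i → c i *ℚ vs i (suc j)))   ≡⟨ sum-zero cvs≡0 ⟩
    0ℚ ∎
  heads+tails≡0 : heads +ℚ tails ≡ 0ℚ
  heads+tails≡0 = begin
    heads +ℚ tails
      ≡⟨ sym (∑-distrib-+ (λ i → c i *ℚ vs i zero) (λ i → c i *ℚ sum (tail (vs i)))) ⟩
    sum (λ i → c i *ℚ vs i zero +ℚ c i *ℚ sum (tail (vs i)))
                                                 ≡⟨ sum-cong-≗ (λ i → sym (ℚₚ.*-distribˡ-+ (c i) _ _)) ⟩
    sum (λ i → c i *ℚ sum (vs i))                ≡⟨ sum-cong-≗ (λ i → cong (c i *ℚ_) (sumᵢ i)) ⟩
    sum (λ i → c i *ℚ (α *ℚ x i))                ≡⟨ sum-cong-≗ (λ i → exchange (c i) α (x i)) ⟩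
    sum (λ i → α *ℚ (c i *ℚ x i))                ≡⟨ sym (*-distribˡ-sum α (λ i → c i *ℚ x i)) ⟩
    α *ℚ sum (λ i → c i *ℚ x i)                  ≡⟨ cong (α *ℚ_) cx≡0 ⟩
    α *ℚ 0ℚ                                      ≡⟨ ℚₚ.*-zeroʳ α ⟩
    0ℚ ∎
    where
    exchange : ∀ a b c → a *ℚ (b *ℚ c) ≡ b *ℚ (a *ℚ c)
    exchange = solve-∀ ℚ-ring
  heads≡0 : heads ≡ 0ℚ
  heads≡0 = begin
    heads            ≡⟨ sym (ℚₚ.+-identityʳ heads) ⟩
    heads +ℚ 0ℚ      ≡⟨ cong (heads +ℚ_) (sym tails≡0) ⟩
    heads +ℚ tails   ≡⟨ heads+tails≡0 ⟩
    0ℚ ∎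

independent-tail : ∀ {k m} {x : Fin k → ℚ} {vs : Fin k → Fin (suc m) → ℚ} →
  Independent x (tail ∘ vs) → Independent x vs
independent-tail independent c (cx≡0 , cvs≡0) = independent c (cx≡0 , cvs≡0 ∘ suc)

independent-singleton : ∀ {m} (v : Fin 1 → Fin m → ℚ) → Independent (λ _ → 1ℚ) v
independent-singleton v c (c1≡0 , _) zero = trans (sym (ℚₚ.*-identityʳ (c zero)))
                                                 (trans (sym (ℚₚ.+-identityʳ _)) c1≡0)

-- Words and the suffix order

count-∷ : ∀ s x (l : List Step) → count s (x ∷ l) ≡ count s (x ∷ []) + count s l
count-∷ E E l = refl
count-∷ E N l = refl
count-∷ N E l = refl
count-∷ N N l = refl

count-++ : ∀ s (l l′ : List Step) → count s (l List.++ l′) ≡ count s l + count s l′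
count-++ s       []      l′ = refl
count-++ E (E ∷ l) l′ = cong suc (count-++ E l l′)
count-++ E (N ∷ l) l′ = count-++ E l l′
count-++ N (N ∷ l) l′ = cong suc (count-++ N l l′)
count-++ N (E ∷ l) l′ = count-++ N l l′

count-E+count-N : ∀ (l : List Step) → count E l + count N l ≡ List.length l
count-E+count-N []      = refl
count-E+count-N (E ∷ l) = cong suc (count-E+count-N l)
count-E+count-N (N ∷ l) = trans (ℕₚ.+-suc _ _) (cong suc (count-E+count-N l))

#E : ∀ {m} → Vec Step m → ℕ
#E w = count E (toList w)

suffix#E : ∀ {m} → Vec Step m → ℕ → ℕ
suffix#E w j = count E (List.drop j (toList w))

_⊑_ : ∀ {m} → Vec Step m → Vec Step m → Set
v ⊑ w = ∀ j → suffix#E v j ≤ suffix#E w j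

Between : ∀ {m} → Vec Step m → Vec Step m → Vec Step m → Set
Between P Q W = P ⊑ W × W ⊑ Q

⊑-refl : ∀ {m} {w : Vec Step m} → w ⊑ w
⊑-refl j = ℕₚ.≤-refl

⊑-∷ : ∀ {m a b} {v w : Vec Step m} → #E (a ∷ v) ≤ #E (b ∷ w) → v ⊑ w → (a ∷ v) ⊑ (b ∷ w)
⊑-∷ head⊑ tail⊑ zero    = head⊑
⊑-∷ head⊑ tail⊑ (suc j) = tail⊑ j

#E≤#E-∷ : ∀ {m} z (w : Vec Step m) → #E w ≤ #E (z ∷ w)
#E≤#E-∷ E w = ℕₚ.n≤1+n _
#E≤#E-∷ N w = ℕₚ.≤-refl

#E-∷≤1+#E : ∀ {m} z (w : Vec Step m) → #E (z ∷ w) ≤ suc (#E w)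
#E-∷≤1+#E E w = ℕₚ.≤-refl
#E-∷≤1+#E N w = ℕₚ.n≤1+n _

#loose : ∀ {m} → Vec Step m → Vec Step m → ℕ
#loose []      []      = 0
#loose (a ∷ P) (b ∷ Q) with #E (a ∷ P) ≟ℕ #E (b ∷ Q)
... | yes _ = #loose P Q
... | no  _ = suc (#loose P Q)

eCoord : Step → ℚ
eCoord E = 1ℚ
eCoord N = 0ℚ

eVector : ∀ {m} → Vec Step m → Fin m → ℚ
eVector w j = eCoord (lookup w j)

sum-eVector : ∀ {m} (w : Vec Step m) → sum (eVector w) ≡ #E w · 1ℚ
sum-eVector []      = refl
sum-eVector (E ∷ w) = cong (1ℚ +ℚ_) (sum-eVector w)
sum-eVector (N ∷ w) = trans (ℚₚ.+-identityˡ _) (sum-eVector w)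

-- The tight suffix constraints bound the rank

-- The suffix constraints of {W ∣ Between P Q W} that hold with equality, homogenised by x.
Tight : ∀ {m} → Vec Step m → Vec Step m → ℚ → (Fin m → ℚ) → Set
Tight []      []      x v = ⊤
Tight (a ∷ P) (b ∷ Q) x v =
  (#E (a ∷ P) ≡ #E (b ∷ Q) → sum v ≡ (#E (a ∷ P) · 1ℚ) *ℚ x) × Tight P Q x (tail v)

tight-+* : ∀ {m} (P Q : Vec Step m) {x y v u} l → Tight P Q x v → Tight P Q y u →
  Tight P Q (x +ℚ l *ℚ y) (λ j → v j +ℚ l *ℚ u j)
tight-+* []      []      l _ _ = tt
tight-+* (a ∷ P) (b ∷ Q) {x} {y} {v} {u} l (sumᵥ , tightᵥ) (sumᵤ , tightᵤ) =
  sumEq , tight-+* P Q l tightᵥ tightᵤ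
  where
  α = #E (a ∷ P) · 1ℚ
  sumEq : #E (a ∷ P) ≡ #E (b ∷ Q) → sum (λ j → v j +ℚ l *ℚ u j) ≡ α *ℚ (x +ℚ l *ℚ y)
  sumEq eq = begin
    sum (λ j → v j +ℚ l *ℚ u j)     ≡⟨ ∑-distrib-+ v (λ j → l *ℚ u j) ⟩
    sum v +ℚ sum (λ j → l *ℚ u j)   ≡⟨ cong (sum v +ℚ_) (sym (*-distribˡ-sum l u)) ⟩
    sum v +ℚ l *ℚ sum u             ≡⟨ cong₂ (λ s t → s +ℚ l *ℚ t) (sumᵥ eq) (sumᵤ eq) ⟩
    α *ℚ x +ℚ l *ℚ (α *ℚ y)         ≡⟨ factor α x l y ⟩
    α *ℚ (x +ℚ l *ℚ y) ∎
    where
    factor : ∀ a x l y → a *ℚ x +ℚ l *ℚ (a *ℚ y) ≡ a *ℚ (x +ℚ l *ℚ y)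
    factor = solve-∀ ℚ-ring

between⇒tight : ∀ {m} {P Q W : Vec Step m} → Between P Q W → Tight P Q 1ℚ (eVector W)
between⇒tight {P = []}    {[]}    {[]}    _ = tt
between⇒tight {P = a ∷ P} {b ∷ Q} {z ∷ W} (P⊑W , W⊑Q) =
  sumEq , between⇒tight (P⊑W ∘ suc , W⊑Q ∘ suc)
  where
  sumEq : #E (a ∷ P) ≡ #E (b ∷ Q) → sum (eVector (z ∷ W)) ≡ (#E (a ∷ P) · 1ℚ) *ℚ 1ℚ
  sumEq eq = begin
    sum (eVector (z ∷ W))     ≡⟨ sum-eVector (z ∷ W) ⟩
    #E (z ∷ W) · 1ℚ           ≡⟨ cong (_· 1ℚ) (ℕₚ.≤-antisym (subst (#E (z ∷ W) ≤_) (sym eq) (W⊑Q 0)) (P⊑W 0)) ⟩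
    #E (a ∷ P) · 1ℚ           ≡⟨ sym (ℚₚ.*-identityʳ _) ⟩
    (#E (a ∷ P) · 1ℚ) *ℚ 1ℚ ∎

TightRank< : ∀ {m} → Vec Step m → Vec Step m → ℕ → Set
TightRank< P Q k = ∀ (x : Fin k → ℚ) vs → (∀ i → Tight P Q (x i) (vs i)) → Dependent x vs

tight-rank-[] : TightRank< [] [] 2
tight-rank-[] x vs _ with clearing-sweep x
... | p , l , cleared = dependent-sweep p l x vs
  ((λ _ → 1ℚ) , (trans (ℚₚ.+-identityʳ _) (trans (ℚₚ.*-identityˡ _) (cleared zero)) , λ ()) , zero , ℚₚ.1≢0)

tight-rank-∷-tight : ∀ {m k} {P Q : Vec Step m} a b → #E (a ∷ P) ≡ #E (b ∷ Q) →
  TightRank< P Q k → TightRank< (a ∷ P) (b ∷ Q) k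
tight-rank-∷-tight {P = P} a b eq rank x vs tight =
  dependent-head-determined (#E (a ∷ P) · 1ℚ) (λ i → proj₁ (tight i) eq) (rank x (tail ∘ vs) (proj₂ ∘ tight))

tight-rank-∷-loose : ∀ {m k} {P Q : Vec Step m} a b → TightRank< P Q k → TightRank< (a ∷ P) (b ∷ Q) (suc k)
tight-rank-∷-loose {P = P} {Q} a b rank x vs tight with clearing-sweep (λ i → vs i zero)
... | p , l , cleared = dependent-sweep p l x vs (dependent-head-zero cleared
  (rank (sweep p l x) (tail ∘ sweepColumns p l vs)
        (λ i → proj₂ (tight-+* (a ∷ P) (b ∷ Q) {v = vs (punchIn p i)} {u = vs p} (l i)
                               (tight (punchIn p i)) (tight p)))))

tight-rank : ∀ {m} (P Q : Vec Step m) → TightRank< P Q (2 + #loose P Q)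
tight-rank []      []      = tight-rank-[]
tight-rank (a ∷ P) (b ∷ Q) with #E (a ∷ P) ≟ℕ #E (b ∷ Q)
... | yes eq = tight-rank-∷-tight a b eq (tight-rank P Q)
... | no  _  = tight-rank-∷-loose a b (tight-rank P Q)

-- An affinely independent family of words

fork : ∀ {k m} → Step → Step → (Fin k → Step) → (Fin (suc k) → Vec Step m) →
  Fin (suc (suc k)) → Vec Step (suc m)
fork z₀ z₁ zs F zero          = z₀ ∷ F zero
fork z₀ z₁ zs F (suc zero)    = z₁ ∷ F zero
fork z₀ z₁ zs F (suc (suc i)) = zs i ∷ F (suc i)

eCoord-independent : ∀ {z₀ z₁} a b → z₀ ≢ z₁ → a *ℚ eCoord z₀ +ℚ b *ℚ eCoord z₁ ≡ 0ℚ → a +ℚ b ≡ 0ℚ →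
  a ≡ 0ℚ × b ≡ 0ℚ
eCoord-independent {E} {E} _ _ z₀≢z₁ = ⊥-elim (z₀≢z₁ refl)
eCoord-independent {N} {N} _ _ z₀≢z₁ = ⊥-elim (z₀≢z₁ refl)
eCoord-independent {E} {N} a b _ a≡0 a+b≡0 =
  trans (sym (select a b)) a≡0 , other a b (trans (sym (select a b)) a≡0) a+b≡0
  where
  select : ∀ a b → a *ℚ 1ℚ +ℚ b *ℚ 0ℚ ≡ a
  select = solve-∀ ℚ-ring
  other : ∀ a b → a ≡ 0ℚ → a +ℚ b ≡ 0ℚ → b ≡ 0ℚ
  other a b refl = trans (sym (ℚₚ.+-identityˡ b))
eCoord-independent {N} {E} a b _ b≡0 a+b≡0 =
  swap (eCoord-independent {E} {N} b a (λ ()) (trans (select a b) b≡0) (trans (ℚₚ.+-comm b a) a+b≡0))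
  where
  select : ∀ a b → b *ℚ 1ℚ +ℚ a *ℚ 0ℚ ≡ a *ℚ 0ℚ +ℚ b *ℚ 1ℚ
  select = solve-∀ ℚ-ring

-- Merging the coefficients of the two copies of F zero yields a relation among F.
independent-fork : ∀ {k m} {z₀ z₁ zs} (F : Fin (suc k) → Vec Step m) → z₀ ≢ z₁ →
  Independent (λ _ → 1ℚ) (eVector ∘ F) → Independent (λ _ → 1ℚ) (eVector ∘ fork z₀ z₁ zs F)
independent-fork {z₀ = z₀} {z₁} {zs} F z₀≢z₁ independent c (c1≡0 , cvs≡0) = c≡0
  where
  merged : Fin _ → ℚ
  merged zero    = c zero +ℚ c (suc zero)
  merged (suc i) = c (suc (suc i))
  regroup : ∀ a b v s → (a +ℚ b) *ℚ v +ℚ s ≡ a *ℚ v +ℚ (b *ℚ v +ℚ s)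
  regroup = solve-∀ ℚ-ring
  merged≡0 : ∀ i → merged i ≡ 0ℚ
  merged≡0 = independent merged
    ( trans (regroup (c zero) (c (suc zero)) 1ℚ (sum (λ i → c (suc (suc i)) *ℚ 1ℚ))) c1≡0
    , λ j → trans (regroup (c zero) (c (suc zero)) (eVector (F zero) j)
                           (sum (λ i → c (suc (suc i)) *ℚ eVector (F (suc i)) j)))
                  (cvs≡0 (suc j)) )
  rest≡0 : sum (λ i → c (suc (suc i)) *ℚ eCoord (zs i)) ≡ 0ℚ
  rest≡0 = sum-zero (λ i → trans (cong (_*ℚ eCoord (zs i)) (merged≡0 (suc i))) (ℚₚ.*-zeroˡ (eCoord (zs i))))
  pair : c zero ≡ 0ℚ × c (suc zero) ≡ 0ℚ
  pair = eCoord-independent (c zero) (c (suc zero)) z₀≢z₁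
    (trans (cong (c zero *ℚ eCoord z₀ +ℚ_) (sym (trans (cong (c (suc zero) *ℚ eCoord z₁ +ℚ_) rest≡0)
                                                          (ℚₚ.+-identityʳ _))))
           (cvs≡0 zero))
    (merged≡0 zero)
  c≡0 : ∀ i → c i ≡ 0ℚ
  c≡0 zero          = proj₁ pair
  c≡0 (suc zero)    = proj₂ pair
  c≡0 (suc (suc i)) = merged≡0 (suc i)

stepTo : ∀ {m} → ℕ → Vec Step m → Step
stepTo t w with t ≟ℕ #E w
... | yes _ = N
... | no  _ = E

#E-stepTo : ∀ {m} t (w : Vec Step m) → #E w ≤ t → t ≤ suc (#E w) → #E (stepTo t w ∷ w) ≡ t
#E-stepTo t w lo hi with t ≟ℕ #E w
... | yes t≡#E = sym t≡#E
... | no  t≢#E = ℕₚ.≤-antisym (ℕₚ.≤∧≢⇒< lo (t≢#E ∘ sym)) hi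

between-stepTo : ∀ {m a b} {P Q W : Vec Step m} t → #E (a ∷ P) ≤ t → t ≤ #E (b ∷ Q) →
  #E W ≤ t → t ≤ suc (#E W) → Between P Q W → Between (a ∷ P) (b ∷ Q) (stepTo t W ∷ W)
between-stepTo {W = W} t a≤t t≤b lo hi (P⊑W , W⊑Q) =
  ⊑-∷ (subst (_ ≤_) (sym #E≡t) a≤t) P⊑W , ⊑-∷ (subst (_≤ _) (sym #E≡t) t≤b) W⊑Q
  where #E≡t = #E-stepTo t W lo hi

-- Prescribing the number of E-steps of the first word is what makes the induction go through.
IndependentWords : ∀ {m} → Vec Step m → Vec Step m → ℕ → Set
IndependentWords {m} P Q r = ∀ t → #E P ≤ t → t ≤ #E Q →
  ∃ λ (F : Fin (suc r) → Vec Step m) →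
    (∀ i → Between P Q (F i)) × Independent (λ _ → 1ℚ) (eVector ∘ F) × #E (F zero) ≡ t

independent-words-[] : IndependentWords [] [] 0
independent-words-[] t z≤n z≤n =
  (λ _ → []) , (λ _ → ⊑-refl , ⊑-refl) , independent-singleton (λ _ → eVector []) , refl

independent-words-∷-tight : ∀ {m r} {P Q : Vec Step m} a b → #E (a ∷ P) ≡ #E (b ∷ Q) →
  (a ∷ P) ⊑ (b ∷ Q) → IndependentWords P Q r → IndependentWords (a ∷ P) (b ∷ Q) r
independent-words-∷-tight {P = P} {Q} a b a≡b aP⊑bQ words t a≤t t≤b
  with words (#E Q) (aP⊑bQ 1) ℕₚ.≤-refl
... | F , between , independent , _ =
  G , (λ i → between-stepTo t a≤t t≤b (lo i) (hi i) (between i)) ,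
  independent-tail independent , #E-stepTo t (F zero) (lo zero) (hi zero)
  where
  t≡a : t ≡ #E (a ∷ P)
  t≡a = ℕₚ.≤-antisym (subst (t ≤_) (sym a≡b) t≤b) a≤t
  G : _ → Vec Step _
  G i = stepTo t (F i) ∷ F i
  lo : ∀ i → #E (F i) ≤ t
  lo i = ℕₚ.≤-trans (proj₂ (between i) 0) (ℕₚ.≤-trans (#E≤#E-∷ b Q) (ℕₚ.≤-reflexive (sym (trans t≡a a≡b))))
  hi : ∀ i → t ≤ suc (#E (F i))
  hi i = subst (_≤ _) (sym t≡a) (ℕₚ.≤-trans (#E-∷≤1+#E a P) (s≤s (proj₁ (between i) 0)))

unit-interval : ∀ {a b t} → a < b → a ≤ t → t ≤ b → ∃ λ u → a ≤ u × suc u ≤ b × u ≤ t × t ≤ suc u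
unit-interval {b = suc b′} {t} a<b a≤t t≤b with suc t ≤? suc b′
... | yes t<b = t , a≤t , t<b , ℕₚ.≤-refl , ℕₚ.n≤1+n t
... | no  t≮b = b′ , s≤s⁻¹ a<b , ℕₚ.≤-refl , ℕₚ.<⇒≤ (s≤s⁻¹ (ℕₚ.≰⇒> t≮b)) , t≤b

otherEnd : ℕ → ℕ → ℕ
otherEnd t u with t ≟ℕ u
... | yes _ = suc u
... | no  _ = u

otherEnd-bounds : ∀ t u → u ≤ otherEnd t u × otherEnd t u ≤ suc u
otherEnd-bounds t u with t ≟ℕ u
... | yes _ = ℕₚ.n≤1+n u , ℕₚ.≤-refl
... | no  _ = ℕₚ.≤-refl , ℕₚ.n≤1+n u

otherEnd≢ : ∀ t u → otherEnd t u ≢ t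
otherEnd≢ t u with t ≟ℕ u
... | yes t≡u = λ 1+u≡t → ℕₚ.1+n≢n (trans 1+u≡t t≡u)
... | no  t≢u = t≢u ∘ sym

-- The first word is used twice, with t and with the other end of [u, 1 + u] E-steps in front.
independent-words-∷-loose : ∀ {m r} {P Q : Vec Step m} a b → #E (a ∷ P) < #E (b ∷ Q) →
  (a ∷ P) ⊑ (b ∷ Q) → IndependentWords P Q r → IndependentWords (a ∷ P) (b ∷ Q) (suc r)
independent-words-∷-loose {P = P} {Q} a b a<b aP⊑bQ words t a≤t t≤b with unit-interval a<b a≤t t≤b
... | u , a≤u , u<b , u≤t , t≤1+u
  with words u (ℕₚ.≤-trans (#E≤#E-∷ a P) a≤u) (s≤s⁻¹ (ℕₚ.≤-trans u<b (#E-∷≤1+#E b Q)))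
... | F , between , independent , #EF₀≡u =
  fork z₀ z₁ zs F , between-fork , independent-fork F z₀≢z₁ independent , #E-z₀
  where
  α = #E (a ∷ P)
  t′ = otherEnd t u
  u≤t′ = proj₁ (otherEnd-bounds t u)
  t′≤1+u = proj₂ (otherEnd-bounds t u)
  z₀ = stepTo t (F zero)
  z₁ = stepTo t′ (F zero)
  zs : _ → Step
  zs i = stepTo (α ⊔ #E (F (suc i))) (F (suc i))
  lo : ∀ {s} → u ≤ s → #E (F zero) ≤ s
  lo = subst (_≤ _) (sym #EF₀≡u)
  hi : ∀ {s} → s ≤ suc u → s ≤ suc (#E (F zero))
  hi = subst (λ v → _ ≤ suc v) (sym #EF₀≡u)
  #E-z₀ : #E (z₀ ∷ F zero) ≡ t
  #E-z₀ = #E-stepTo t (F zero) (lo u≤t) (hi t≤1+u)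
  #E-z₁ : #E (z₁ ∷ F zero) ≡ t′
  #E-z₁ = #E-stepTo t′ (F zero) (lo u≤t′) (hi t′≤1+u)
  z₀≢z₁ : z₀ ≢ z₁
  z₀≢z₁ z₀≡z₁ = otherEnd≢ t u (trans (sym #E-z₁) (trans (cong (λ z → #E (z ∷ F zero)) (sym z₀≡z₁)) #E-z₀))
  between-fork : ∀ i → Between (a ∷ P) (b ∷ Q) (fork z₀ z₁ zs F i)
  between-fork zero = between-stepTo t a≤t t≤b (lo u≤t) (hi t≤1+u) (between zero)
  between-fork (suc zero) =
    between-stepTo t′ (ℕₚ.≤-trans a≤u u≤t′) (ℕₚ.≤-trans t′≤1+u u<b) (lo u≤t′) (hi t′≤1+u) (between zero)
  between-fork (suc (suc i)) =
    between-stepTo (α ⊔ #E W) (ℕₚ.m≤m⊔n α _)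
      (ℕₚ.⊔-lub (ℕₚ.<⇒≤ a<b) (ℕₚ.≤-trans (proj₂ (between (suc i)) 0) (#E≤#E-∷ b Q)))
      (ℕₚ.m≤n⊔m α _)
      (ℕₚ.⊔-lub (ℕₚ.≤-trans (#E-∷≤1+#E a P) (s≤s (proj₁ (between (suc i)) 0))) (ℕₚ.n≤1+n _))
      (between (suc i))
    where W = F (suc i)

independent-words : ∀ {m} (P Q : Vec Step m) → P ⊑ Q → IndependentWords P Q (#loose P Q)
independent-words []      []      _   = independent-words-[]
independent-words (a ∷ P) (b ∷ Q) P⊑Q with #E (a ∷ P) ≟ℕ #E (b ∷ Q)
... | yes a≡b = independent-words-∷-tight a b a≡b P⊑Q (independent-words P Q (P⊑Q ∘ suc))
... | no  a≢b = independent-words-∷-loose a b (ℕₚ.≤∧≢⇒< (P⊑Q 0) a≢b) P⊑Q (independent-words P Q (P⊑Q ∘ suc))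

-- Symmetric paths and their second halves

half : ∀ {n} → LatticePath n → Vec Step n
half {n} r = Vec.drop n (word r)

lookup-drop : ∀ {A : Set} m {k} (w : Vec A (m + k)) j → lookup w (m ↑ʳ j) ≡ lookup (Vec.drop m w) j
lookup-drop zero    w       j = refl
lookup-drop (suc m) (x ∷ w) j = lookup-drop m w j

toList-drop : ∀ {A : Set} m {k} (w : Vec A (m + k)) → toList (Vec.drop m w) ≡ List.drop m (toList w)
toList-drop zero    w       = refl
toList-drop (suc m) (x ∷ w) = toList-drop m w

suffix#E-drop : ∀ m {k} (w : Vec Step (m + k)) j → suffix#E (Vec.drop m w) j ≡ suffix#E w (m + j)
suffix#E-drop m w j = begin
  count E (List.drop j (toList (Vec.drop m w)))   ≡⟨ cong (count E ∘ List.drop j) (toList-drop m w) ⟩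
  count E (List.drop j (List.drop m (toList w)))  ≡⟨ cong (count E) (Listₚ.drop-drop m j (toList w)) ⟩
  count E (List.drop (m + j) (toList w)) ∎

suffix#E-beyond : ∀ {m} (w : Vec Step m) j → m ≤ j → suffix#E w j ≡ 0
suffix#E-beyond w j m≤j =
  cong (count E) (Listₚ.drop-all j (toList w) (subst (_≤ j) (sym (Vecₚ.length-toList w)) m≤j))

label-≥ : ∀ {n} (i : Fin (n + n)) → n ≤ toℕ i → label {n} i ≡ ℤ.+ suc (toℕ i ∸ n)
label-≥ {n} i n≤i with toℕ i <? n
... | yes i<n = ⊥-elim (ℕₚ.<⇒≱ i<n n≤i)
... | no  _   = begin
  (ℤ.+ toℕ i ℤ.- ℤ.+ n) ℤ.+ ℤ.+ 1  ≡⟨ cong (ℤ._+ ℤ.+ 1) (trans (ℤₚ.m-n≡m⊖n (toℕ i) n) (ℤₚ.⊖-≥ n≤i)) ⟩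
  ℤ.+ (toℕ i ∸ n + 1)                ≡⟨ cong ℤ.+_ (ℕₚ.+-comm (toℕ i ∸ n) 1) ⟩
  ℤ.+ suc (toℕ i ∸ n) ∎

label-< : ∀ {n} (i : Fin (n + n)) → toℕ i < n → label {n} i ≡ ℤ.- ℤ.+ (n ∸ toℕ i)
label-< {n} i i<n with toℕ i <? n
... | yes _   = trans (ℤₚ.m-n≡m⊖n (toℕ i) n) (ℤₚ.⊖-< i<n)
... | no  i≮n = ⊥-elim (i≮n i<n)

label-↑ʳ : ∀ n (j : Fin n) → label {n} (n ↑ʳ j) ≡ ℤ.+ suc (toℕ j)
label-↑ʳ n j = begin
  label {n} (n ↑ʳ j)           ≡⟨ label-≥ (n ↑ʳ j) (subst (n ≤_) (sym toℕ-n↑j) (ℕₚ.m≤m+n n (toℕ j))) ⟩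
  ℤ.+ suc (toℕ (n ↑ʳ j) ∸ n)   ≡⟨ cong (λ t → ℤ.+ suc (t ∸ n)) toℕ-n↑j ⟩
  ℤ.+ suc (n + toℕ j ∸ n)      ≡⟨ cong (λ t → ℤ.+ suc t) (ℕₚ.m+n∸m≡n n (toℕ j)) ⟩
  ℤ.+ suc (toℕ j) ∎
  where toℕ-n↑j = Finₚ.toℕ-↑ʳ n j

label≡⇒↑ʳ : ∀ {n} (i : Fin (n + n)) (j : Fin n) → label {n} i ≡ ℤ.+ suc (toℕ j) → i ≡ n ↑ʳ j
label≡⇒↑ʳ {n} i j label≡ with n ≤? toℕ i
... | yes n≤i = Finₚ.toℕ-injective (begin
  toℕ i               ≡⟨ sym (ℕₚ.m+[n∸m]≡n n≤i) ⟩
  n + (toℕ i ∸ n)     ≡⟨ cong (λ t → n + t) (ℕₚ.suc-injective (ℤₚ.+-injective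
                                                (trans (sym (label-≥ i n≤i)) label≡))) ⟩
  n + toℕ j           ≡⟨ sym (Finₚ.toℕ-↑ʳ n j) ⟩
  toℕ (n ↑ʳ j) ∎)
... | no  n≰i = ⊥-elim (nonpositive (trans (sym (label-< i (ℕₚ.≰⇒> n≰i))) label≡))
  where
  nonpositive : ∀ {k m} → ℤ.- ℤ.+ k ≢ ℤ.+ suc m
  nonpositive {zero}  ()
  nonpositive {suc k} ()

indicator≡eVector-half : ∀ {n} (r : LatticePath n) j → indicator r j ≡ eVector (half r) j
indicator≡eVector-half {n} r j with ℤ.+ suc (toℕ j) ∈? labL r
... | yes member with ∈-map⁻ (label {n}) member
...   | i , i∈Es , j≡label with ∈-filter⁻ {P = λ i → lookup (word r) i ≡ E} _ {xs = List.allFin (n + n)} i∈Es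
...     | _ , stepᵢ≡E = cong eCoord (sym (begin
  lookup (half r) j          ≡⟨ sym (lookup-drop n (word r) j) ⟩
  lookup (word r) (n ↑ʳ j)   ≡⟨ cong (lookup (word r)) (sym (label≡⇒↑ʳ i j (sym j≡label))) ⟩
  lookup (word r) i          ≡⟨ stepᵢ≡E ⟩
  E ∎))
indicator≡eVector-half {n} r j | no nonmember with lookup (half r) j in stepⱼ
... | N = refl
... | E = ⊥-elim (nonmember (subst (_∈ labL r) (label-↑ʳ n j)
  (∈-map⁺ (label {n}) (∈-filter⁺ {P = λ i → lookup (word r) i ≡ E} _ (∈-allFin (n ↑ʳ j))
                                  (trans (lookup-drop n (word r) j) stepⱼ)))))

height : ∀ {n} → LatticePath n → ℕ → ℕ
height r k = count N (List.take k (toList (word r)))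

prefix#E+suffix#E≡n : ∀ {n} (r : LatticePath n) k → proj₁ (point r k) + suffix#E (word r) k ≡ n
prefix#E+suffix#E≡n r k = begin
  count E (List.take k l) + count E (List.drop k l)  ≡⟨ sym (count-++ E (List.take k l) (List.drop k l)) ⟩
  count E (List.take k l List.++ List.drop k l)      ≡⟨ cong (count E) (Listₚ.take++drop≡id k l) ⟩
  count E l                                          ≡⟨ #E≡n r ⟩
  _ ∎
  where l = toList (word r)

height+n≡k+suffix#E : ∀ {n} (r : LatticePath n) k → k ≤ n + n → height r k + n ≡ k + suffix#E (word r) k
height+n≡k+suffix#E {n} r k k≤2n = begin
  h + n                                ≡⟨ cong (h +_) (sym (prefix#E+suffix#E≡n r k)) ⟩
  h + (count E (List.take k l) + s)    ≡⟨ sym (ℕₚ.+-assoc h _ s) ⟩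
  h + count E (List.take k l) + s      ≡⟨ cong (_+ s) (ℕₚ.+-comm h _) ⟩
  count E (List.take k l) + h + s      ≡⟨ cong (_+ s) (count-E+count-N (List.take k l)) ⟩
  List.length (List.take k l) + s      ≡⟨ cong (_+ s) (Listₚ.length-take k l) ⟩
  k ⊓ List.length l + s                ≡⟨ cong (_+ s) (ℕₚ.m≤n⇒m⊓n≡m k≤length) ⟩
  k + s ∎
  where
  l = toList (word r)
  h = height r k
  s = suffix#E (word r) k
  k≤length = subst (k ≤_) (sym (Vecₚ.length-toList (word r))) k≤2n

height≤⇒suffix#E≤ : ∀ {n} (p r : LatticePath n) k → k ≤ n + n →
  height p k ≤ height r k → suffix#E (word p) k ≤ suffix#E (word r) k
height≤⇒suffix#E≤ {n} p r k k≤2n hₚ≤hᵣ = ℕₚ.+-cancelˡ-≤ k _ _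
  (subst₂ _≤_ (height+n≡k+suffix#E p k k≤2n) (height+n≡k+suffix#E r k k≤2n) (ℕₚ.+-monoˡ-≤ n hₚ≤hᵣ))

suffix#E≤⇒height≤ : ∀ {n} (p r : LatticePath n) k → k ≤ n + n →
  suffix#E (word p) k ≤ suffix#E (word r) k → height p k ≤ height r k
suffix#E≤⇒height≤ {n} p r k k≤2n sₚ≤sᵣ = ℕₚ.+-cancelʳ-≤ n _ _
  (subst₂ _≤_ (sym (height+n≡k+suffix#E p k k≤2n)) (sym (height+n≡k+suffix#E r k k≤2n)) (ℕₚ.+-monoʳ-≤ k sₚ≤sᵣ))

≼⇒⊑-half : ∀ {n} (p r : LatticePath n) → p ≼ r → half p ⊑ half r
≼⇒⊑-half {n} p r p≼r j with j ≤? n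
... | yes j≤n = subst₂ _≤_ (sym (suffix#E-drop n (word p) j)) (sym (suffix#E-drop n (word r) j))
                  (height≤⇒suffix#E≤ p r (n + j) n+j≤2n (p≼r (n + j) n+j≤2n))
  where n+j≤2n = ℕₚ.+-monoʳ-≤ n j≤n
... | no  j≰n = subst₂ _≤_ (sym (suffix#E-beyond (half p) j n≤j))
                          (sym (suffix#E-beyond (half r) j n≤j)) z≤n
  where n≤j = ℕₚ.<⇒≤ (ℕₚ.≰⇒> j≰n)

count-take-suc : ∀ s {m} (w : Vec Step m) (i : Fin m) →
  count s (List.take (suc (toℕ i)) (toList w))
    ≡ count s (List.take (toℕ i) (toList w)) + count s (lookup w i ∷ [])
count-take-suc s (x ∷ w) zero    = refl
count-take-suc s (x ∷ w) (suc i) = begin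
  count s (x ∷ prefix₊)           ≡⟨ count-∷ s x prefix₊ ⟩
  cₓ + count s prefix₊            ≡⟨ cong (cₓ +_) (count-take-suc s w i) ⟩
  cₓ + (count s prefix + cᵢ)      ≡⟨ sym (ℕₚ.+-assoc cₓ _ cᵢ) ⟩
  cₓ + count s prefix + cᵢ        ≡⟨ cong (_+ cᵢ) (sym (count-∷ s x prefix)) ⟩
  count s (x ∷ prefix) + cᵢ ∎
  where
  prefix  = List.take (toℕ i) (toList w)
  prefix₊ = List.take (suc (toℕ i)) (toList w)
  cₓ = count s (x ∷ [])
  cᵢ = count s (lookup w i ∷ [])

count-drop-lookup : ∀ s {m} (w : Vec Step m) (i : Fin m) →
  count s (List.drop (toℕ i) (toList w))
    ≡ count s (lookup w i ∷ []) + count s (List.drop (suc (toℕ i)) (toList w))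
count-drop-lookup s (x ∷ w) zero    = count-∷ s x (toList w)
count-drop-lookup s (x ∷ w) (suc i) = count-drop-lookup s w i

count-N≡count-E : ∀ {x y} → x ≢ y → count N (x ∷ []) ≡ count E (y ∷ [])
count-N≡count-E {E} {E} x≢y = ⊥-elim (x≢y refl)
count-N≡count-E {E} {N} _   = refl
count-N≡count-E {N} {E} _   = refl
count-N≡count-E {N} {N} x≢y = ⊥-elim (x≢y refl)

prefix#N≡suffix#E : ∀ {m} (w : Vec Step m) k → k ≤ m →
  (∀ (i : Fin m) → toℕ i < k → lookup w i ≢ lookup w (opposite i)) →
  count N (List.take k (toList w)) ≡ suffix#E w (m ∸ k)
prefix#N≡suffix#E {m} w zero _ _ = sym (suffix#E-beyond w m ℕₚ.≤-refl)
prefix#N≡suffix#E {m} w (suc k) k<m complementary = begin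
  count N (List.take (suc k) l)                   ≡⟨ cong (λ t → count N (List.take (suc t) l)) (sym toℕi) ⟩
  count N (List.take (suc (toℕ i)) l)             ≡⟨ count-take-suc N w i ⟩
  count N (List.take (toℕ i) l) + count N (wᵢ ∷ [])
        ≡⟨ cong₂ _+_ (trans (cong (λ t → count N (List.take t l)) toℕi) prefix) (count-N≡count-E wᵢ≢wₒ) ⟩
  suffix#E w (m ∸ k) + count E (wₒ ∷ [])          ≡⟨ ℕₚ.+-comm (suffix#E w (m ∸ k)) _ ⟩
  count E (wₒ ∷ []) + suffix#E w (m ∸ k)          ≡⟨ cong (λ t → count E (wₒ ∷ []) + suffix#E w t) m∸k≡1+o ⟩
  count E (wₒ ∷ []) + suffix#E w (suc (toℕ o))    ≡⟨ sym (count-drop-lookup E w o) ⟩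
  suffix#E w (toℕ o)                              ≡⟨ cong (suffix#E w) toℕo ⟩
  suffix#E w (m ∸ suc k) ∎
  where
  l = toList w
  i = fromℕ< k<m
  o = opposite i
  wᵢ = lookup w i
  wₒ = lookup w o
  toℕi : toℕ i ≡ k
  toℕi = Finₚ.toℕ-fromℕ< k<m
  toℕo : toℕ o ≡ m ∸ suc k
  toℕo = trans (Finₚ.opposite-prop i) (cong (λ t → m ∸ suc t) toℕi)
  m∸k≡1+o : m ∸ k ≡ suc (toℕ o)
  m∸k≡1+o = trans (ℕₚ.+-∸-assoc 1 k<m) (cong suc (sym toℕo))
  wᵢ≢wₒ : wᵢ ≢ wₒ
  wᵢ≢wₒ = complementary i (subst (_< suc k) (sym toℕi) ℕₚ.≤-refl)
  prefix = prefix#N≡suffix#E w k (ℕₚ.<⇒≤ k<m) (λ j j<k → complementary j (ℕₚ.m<n⇒m<1+n j<k))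

height-symmetric : ∀ {n} (r : LatticePath n) → Symmetric r → ∀ k → k ≤ n → height r k ≡ suffix#E (half r) (n ∸ k)
height-symmetric {n} r symmetric k k≤n = begin
  height r k                         ≡⟨ prefix#N≡suffix#E (word r) k (ℕₚ.≤-trans k≤n (ℕₚ.m≤m+n n n))
                                          (λ i i<k → symmetric i (ℕₚ.<-≤-trans i<k k≤n)) ⟩
  suffix#E (word r) (n + n ∸ k)      ≡⟨ cong (suffix#E (word r)) (ℕₚ.+-∸-assoc n k≤n) ⟩
  suffix#E (word r) (n + (n ∸ k))    ≡⟨ sym (suffix#E-drop n (word r) (n ∸ k)) ⟩
  suffix#E (half r) (n ∸ k) ∎

⊑-half⇒≼ : ∀ {n} (p r : LatticePath n) → Symmetric p → Symmetric r → half p ⊑ half r → p ≼ r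
⊑-half⇒≼ {n} p r p-symmetric r-symmetric half⊑ k k≤2n with n ≤? k
... | yes n≤k = suffix#E≤⇒height≤ p r k k≤2n (subst₂ _≤_ (suffix#E-word p) (suffix#E-word r) (half⊑ (k ∸ n)))
  where
  suffix#E-word : ∀ r → suffix#E (half r) (k ∸ n) ≡ suffix#E (word r) k
  suffix#E-word r = trans (suffix#E-drop n (word r) (k ∸ n)) (cong (suffix#E (word r)) (ℕₚ.m+[n∸m]≡n n≤k))
... | no  n≰k = subst₂ _≤_ (sym (height-symmetric p p-symmetric k k≤n))
                          (sym (height-symmetric r r-symmetric k k≤n)) (half⊑ (n ∸ k))
  where k≤n = ℕₚ.<⇒≤ (ℕₚ.≰⇒> n≰k)

flip : Step → Step
flip E = N
flip N = E

flip≢ : ∀ x → flip x ≢ x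
flip≢ E ()
flip≢ N ()

count-flip : ∀ s x → count s (flip x ∷ []) ≡ count (flip s) (x ∷ [])
count-flip E E = refl
count-flip E N = refl
count-flip N E = refl
count-flip N N = refl

count+count-flip : ∀ s (l : List Step) → count s l + count (flip s) l ≡ List.length l
count+count-flip E l = count-E+count-N l
count+count-flip N l = trans (ℕₚ.+-comm (count N l) _) (count-E+count-N l)

-- The reverse complement: the path obtained by a half-turn rotation.
mirror : ∀ {m} → Vec Step m → Vec Step m
mirror []      = []
mirror (x ∷ w) = mirror w Vec.∷ʳ flip x

lookup-∷ʳ-fromℕ : ∀ {A : Set} {m} (w : Vec A m) x → lookup (w Vec.∷ʳ x) (fromℕ m) ≡ x
lookup-∷ʳ-fromℕ []      x = refl
lookup-∷ʳ-fromℕ (y ∷ w) x = lookup-∷ʳ-fromℕ w x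

lookup-∷ʳ-inject₁ : ∀ {A : Set} {m} (w : Vec A m) x i → lookup (w Vec.∷ʳ x) (inject₁ i) ≡ lookup w i
lookup-∷ʳ-inject₁ (y ∷ w) x zero    = refl
lookup-∷ʳ-inject₁ (y ∷ w) x (suc i) = lookup-∷ʳ-inject₁ w x i

lookup-mirror : ∀ {m} (w : Vec Step m) i → lookup (mirror w) (opposite i) ≡ flip (lookup w i)
lookup-mirror (x ∷ w) zero    = lookup-∷ʳ-fromℕ (mirror w) (flip x)
lookup-mirror (x ∷ w) (suc i) = trans (lookup-∷ʳ-inject₁ (mirror w) (flip x) (opposite i)) (lookup-mirror w i)

count-mirror : ∀ s {m} (w : Vec Step m) → count s (toList (mirror w)) ≡ count (flip s) (toList w)
count-mirror s []      = refl
count-mirror s (x ∷ w) = begin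
  count s (toList (mirror w Vec.∷ʳ flip x))                ≡⟨ cong (count s) (Vecₚ.toList-∷ʳ (flip x) (mirror w)) ⟩
  count s (toList (mirror w) List.++ flip x ∷ [])          ≡⟨ count-++ s (toList (mirror w)) _ ⟩
  count s (toList (mirror w)) + count s (flip x ∷ [])      ≡⟨ cong₂ _+_ (count-mirror s w) (count-flip s x) ⟩
  count (flip s) (toList w) + count (flip s) (x ∷ [])      ≡⟨ ℕₚ.+-comm (count (flip s) (toList w)) _ ⟩
  count (flip s) (x ∷ []) + count (flip s) (toList w)      ≡⟨ sym (count-∷ (flip s) x (toList w)) ⟩
  count (flip s) (x ∷ toList w) ∎

count-mirror-++ : ∀ s {m} (w : Vec Step m) → count s (toList (mirror w Vec.++ w)) ≡ m
count-mirror-++ s {m} w = begin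
  count s (toList (mirror w Vec.++ w))                     ≡⟨ cong (count s) (Vecₚ.toList-++ (mirror w) w) ⟩
  count s (toList (mirror w) List.++ toList w)             ≡⟨ count-++ s (toList (mirror w)) (toList w) ⟩
  count s (toList (mirror w)) + count s (toList w)         ≡⟨ cong (_+ count s (toList w)) (count-mirror s w) ⟩
  count (flip s) (toList w) + count s (toList w)           ≡⟨ ℕₚ.+-comm (count (flip s) (toList w)) _ ⟩
  count s (toList w) + count (flip s) (toList w)           ≡⟨ count+count-flip s (toList w) ⟩
  List.length (toList w)                                   ≡⟨ Vecₚ.length-toList w ⟩
  m ∎

symmetricPath : ∀ {n} → Vec Step n → LatticePath n
symmetricPath w = mkPath (mirror w Vec.++ w) (count-mirror-++ E w) (count-mirror-++ N w)

drop-++ : ∀ {A : Set} {m k} (v : Vec A m) (w : Vec A k) → Vec.drop m (v Vec.++ w) ≡ w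
drop-++ []      w = refl
drop-++ (x ∷ v) w = drop-++ v w

half-symmetricPath : ∀ {n} (w : Vec Step n) → half (symmetricPath w) ≡ w
half-symmetricPath w = drop-++ (mirror w) w

symmetricPath-symmetric : ∀ {n} (w : Vec Step n) → Symmetric (symmetricPath w)
symmetricPath-symmetric {n} w i i<n vᵢ≡vₒ = flip≢ (lookup w (opposite j)) (begin
  flip (lookup w (opposite j))                 ≡⟨ sym (lookup-mirror w (opposite j)) ⟩
  lookup (mirror w) (opposite (opposite j))    ≡⟨ cong (lookup (mirror w)) (Finₚ.opposite-involutive j) ⟩
  lookup (mirror w) j                          ≡⟨ sym (Vecₚ.lookup-++ˡ (mirror w) w j) ⟩
  lookup v (j ↑ˡ n)                            ≡⟨ cong (lookup v) (sym i≡j↑ˡn) ⟩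
  lookup v i                                   ≡⟨ vᵢ≡vₒ ⟩
  lookup v (opposite i)                        ≡⟨ cong (lookup v) opposite-i≡n↑ʳ ⟩
  lookup v (n ↑ʳ opposite j)                   ≡⟨ Vecₚ.lookup-++ʳ (mirror w) w (opposite j) ⟩
  lookup w (opposite j) ∎)
  where
  v = mirror w Vec.++ w
  j = fromℕ< i<n
  toℕj : toℕ j ≡ toℕ i
  toℕj = Finₚ.toℕ-fromℕ< i<n
  i≡j↑ˡn : i ≡ j ↑ˡ n
  i≡j↑ˡn = Finₚ.toℕ-injective (sym (trans (Finₚ.toℕ-↑ˡ j n) toℕj))
  opposite-i≡n↑ʳ : opposite i ≡ n ↑ʳ opposite j
  opposite-i≡n↑ʳ = Finₚ.toℕ-injective (begin
    toℕ (opposite i)              ≡⟨ Finₚ.opposite-prop i ⟩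
    n + n ∸ suc (toℕ i)           ≡⟨ ℕₚ.+-∸-assoc n i<n ⟩
    n + (n ∸ suc (toℕ i))         ≡⟨ cong (λ t → n + (n ∸ suc t)) (sym toℕj) ⟩
    n + (n ∸ suc (toℕ j))         ≡⟨ cong (λ t → n + t) (sym (Finₚ.opposite-prop j)) ⟩
    n + toℕ (opposite j)          ≡⟨ sym (Finₚ.toℕ-↑ʳ n (opposite j)) ⟩
    toℕ (n ↑ʳ opposite j) ∎)

feasible-eVector : ∀ {n} (p q : LatticePath n) {W} → Symmetric p → Symmetric q →
  Between (half p) (half q) W → FeasibleVector p q (eVector W)
feasible-eVector p q {W} p-symmetric q-symmetric (P⊑W , W⊑Q) =
  r , r-symmetric ,
  ⊑-half⇒≼ p r p-symmetric r-symmetric (subst (half p ⊑_) (sym (half-symmetricPath W)) P⊑W) ,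
  ⊑-half⇒≼ r q r-symmetric q-symmetric (subst (_⊑ half q) (sym (half-symmetricPath W)) W⊑Q) ,
  λ j → sym (trans (indicator≡eVector-half r j) (cong (λ w → eVector w j) (half-symmetricPath W)))
  where
  r = symmetricPath W
  r-symmetric = symmetricPath-symmetric W

feasible⇒between : ∀ {n} (p q : LatticePath n) {v} → FeasibleVector p q v →
  ∃ λ W → Between (half p) (half q) W × (∀ j → v j ≡ eVector W j)
feasible⇒between p q (r , _ , p≼r , r≼q , v≡indicator) =
  half r , (≼⇒⊑-half p r p≼r , ≼⇒⊑-half r q r≼q) , λ j → trans (v≡indicator j) (indicator≡eVector-half r j)

-- Common points of p and q

length-filter-skip : ∀ {P : Pred ℕ 0ℓ} (P? : Decidable P) (f : ℕ → ℕ) a b → (∀ i → i < a → ¬ P (f i)) →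
  length (filter P? (applyUpTo f (a + b))) ≡ length (filter P? (applyUpTo (λ i → f (a + i)) b))
length-filter-skip P? f zero    b _      = refl
length-filter-skip P? f (suc a) b ¬P[f<] with P? (f 0)
... | yes P[f0] = ⊥-elim (¬P[f<] 0 (s≤s z≤n) P[f0])
... | no  _     = length-filter-skip P? (f ∘ suc) a b (λ i i<a → ¬P[f<] (suc i) (s≤s i<a))

length-filter-applyUpTo : ∀ {P Q : Pred ℕ 0ℓ} (P? : Decidable P) (Q? : Decidable Q) (f g : ℕ → ℕ) m →
  (∀ j → j < m → (P (f j) → Q (g j)) × (Q (g j) → P (f j))) →
  length (filter P? (applyUpTo f m)) ≡ length (filter Q? (applyUpTo g m))
length-filter-applyUpTo P? Q? f g zero    _     = refl
length-filter-applyUpTo P? Q? f g (suc m) P⇔Q with P? (f 0) | Q? (g 0)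
... | yes _  | yes _  = cong suc IH
  where IH = length-filter-applyUpTo P? Q? (f ∘ suc) (g ∘ suc) m (λ j j<m → P⇔Q (suc j) (s≤s j<m))
... | no  _  | no  _  = length-filter-applyUpTo P? Q? (f ∘ suc) (g ∘ suc) m (λ j j<m → P⇔Q (suc j) (s≤s j<m))
... | yes P₀ | no ¬Q₀ = ⊥-elim (¬Q₀ (proj₁ (P⇔Q 0 (s≤s z≤n)) P₀))
... | no ¬P₀ | yes Q₀ = ⊥-elim (¬P₀ (proj₂ (P⇔Q 0 (s≤s z≤n)) Q₀))

suffix#E-≟ : ∀ {m} (P Q : Vec Step m) → Decidable (λ j → suffix#E P j ≡ suffix#E Q j)
suffix#E-≟ P Q j = suffix#E P j ≟ℕ suffix#E Q j

length-filter-suffix#E-≟-∷ : ∀ {m} {a b} (P Q : Vec Step m) →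
  length (filter (suffix#E-≟ (a ∷ P) (b ∷ Q)) (applyUpTo suc (suc m)))
    ≡ length (filter (suffix#E-≟ P Q) (upTo (suc m)))
length-filter-suffix#E-≟-∷ {m} {a} {b} P Q =
  length-filter-applyUpTo (suffix#E-≟ (a ∷ P) (b ∷ Q)) (suffix#E-≟ P Q) suc (λ j → j) (suc m)
                          (λ _ _ → (λ eq → eq) , (λ eq → eq))

#tight+#loose : ∀ {m} (P Q : Vec Step m) → length (filter (suffix#E-≟ P Q) (upTo (suc m))) + #loose P Q ≡ suc m
#tight+#loose []      []      = refl
#tight+#loose {suc m} (a ∷ P) (b ∷ Q) with #E (a ∷ P) ≟ℕ #E (b ∷ Q)
... | yes a≡b = begin
  length (filter tight? (0 ∷ applyUpTo suc (suc m))) + #loose P Q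
    ≡⟨ cong (λ xs → length xs + #loose P Q)
            (Listₚ.filter-accept tight? {x = 0} {xs = applyUpTo suc (suc m)} a≡b) ⟩
  suc (length (filter tight? (applyUpTo suc (suc m))) + #loose P Q)
    ≡⟨ cong (λ t → suc (t + #loose P Q)) (length-filter-suffix#E-≟-∷ P Q) ⟩
  suc (length (filter (suffix#E-≟ P Q) (upTo (suc m))) + #loose P Q)
    ≡⟨ cong suc (#tight+#loose P Q) ⟩
  suc (suc m) ∎
  where tight? = suffix#E-≟ (a ∷ P) (b ∷ Q)
... | no a≢b = begin
  length (filter tight? (0 ∷ applyUpTo suc (suc m))) + suc (#loose P Q)
    ≡⟨ cong (λ xs → length xs + suc (#loose P Q))
            (Listₚ.filter-reject tight? {x = 0} {xs = applyUpTo suc (suc m)} a≢b) ⟩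
  length (filter tight? (applyUpTo suc (suc m))) + suc (#loose P Q)
    ≡⟨ cong (_+ suc (#loose P Q)) (length-filter-suffix#E-≟-∷ P Q) ⟩
  length (filter (suffix#E-≟ P Q) (upTo (suc m))) + suc (#loose P Q)
    ≡⟨ ℕₚ.+-suc _ (#loose P Q) ⟩
  suc (length (filter (suffix#E-≟ P Q) (upTo (suc m))) + #loose P Q)
    ≡⟨ cong suc (#tight+#loose P Q) ⟩
  suc (suc m) ∎
  where tight? = suffix#E-≟ (a ∷ P) (b ∷ Q)

point≡⇒suffix#E≡ : ∀ {n} (p q : LatticePath n) k →
  point p k ≡ point q k → suffix#E (word p) k ≡ suffix#E (word q) k
point≡⇒suffix#E≡ p q k p≡q = ℕₚ.+-cancelˡ-≡ (proj₁ (point p k)) _ _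
  (trans (prefix#E+suffix#E≡n p k) (trans (sym (prefix#E+suffix#E≡n q k))
         (cong (_+ suffix#E (word q) k) (sym (cong proj₁ p≡q)))))

suffix#E≡⇒point≡ : ∀ {n} (p q : LatticePath n) k → k ≤ n + n →
  suffix#E (word p) k ≡ suffix#E (word q) k → point p k ≡ point q k
suffix#E≡⇒point≡ {n} p q k k≤2n suffixes≡ = cong₂ _,_
  (ℕₚ.+-cancelʳ-≡ (suffix#E (word p) k) _ _
    (trans (prefix#E+suffix#E≡n p k)
           (trans (sym (prefix#E+suffix#E≡n q k)) (cong (proj₁ (point q k) +_) (sym suffixes≡)))))
  (ℕₚ.+-cancelʳ-≡ n _ _
    (trans (height+n≡k+suffix#E p k k≤2n) (trans (cong (k +_) suffixes≡) (sym (height+n≡k+suffix#E q k k≤2n)))))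

commonAbove+#loose : ∀ {n} (p q : LatticePath n) → commonAbove p q + #loose (half p) (half q) ≡ suc n
commonAbove+#loose {n} p q = begin
  length (filter common? (upTo (suc (n + n)))) + L
    ≡⟨ cong (λ m → length (filter common? (upTo m)) + L) (sym (ℕₚ.+-suc n n)) ⟩
  length (filter common? (upTo (n + suc n))) + L
    ≡⟨ cong (_+ L) (length-filter-skip common? (λ t → t) n (suc n) (λ t t<n common → ℕₚ.<⇒≱ t<n (proj₁ common))) ⟩
  length (filter common? (applyUpTo (λ j → n + j) (suc n))) + L
    ≡⟨ cong (_+ L) (length-filter-applyUpTo common? (suffix#E-≟ (half p) (half q))
                                            (λ j → n + j) (λ j → j) (suc n) common⇔tight) ⟩
  length (filter (suffix#E-≟ (half p) (half q)) (upTo (suc n))) + L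
    ≡⟨ #tight+#loose (half p) (half q) ⟩
  suc n ∎
  where
  L = #loose (half p) (half q)
  common? = λ t → (n ≤? t) ×-dec ≡-dec _≟ℕ_ _≟ℕ_ (point p t) (point q t)
  suffix#E-half : ∀ r j → suffix#E (half r) j ≡ suffix#E (word r) (n + j)
  suffix#E-half r j = suffix#E-drop n (word r) j
  common⇔tight : ∀ j → j < suc n →
    (n ≤ n + j × point p (n + j) ≡ point q (n + j) → suffix#E (half p) j ≡ suffix#E (half q) j) ×
    (suffix#E (half p) j ≡ suffix#E (half q) j → n ≤ n + j × point p (n + j) ≡ point q (n + j))
  common⇔tight j j≤n =
    (λ (_ , p≡q) → trans (suffix#E-half p j)
                         (trans (point≡⇒suffix#E≡ p q (n + j) p≡q) (sym (suffix#E-half q j)))) ,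
    (λ suffixes≡ → ℕₚ.m≤m+n n j , suffix#E≡⇒point≡ p q (n + j) (ℕₚ.+-monoʳ-≤ n (s≤s⁻¹ j≤n))
                  (trans (sym (suffix#E-half p j)) (trans suffixes≡ (suffix#E-half q j))))

#loose≡suc-n∸commonAbove : ∀ {n} (p q : LatticePath n) → #loose (half p) (half q) ≡ suc n ∸ commonAbove p q
#loose≡suc-n∸commonAbove p q =
  trans (sym (ℕₚ.m+n∸m≡n (commonAbove p q) _)) (cong (_∸ commonAbove p q) (commonAbove+#loose p q))

proposition4p5 : (n : ℕ) (p q : LatticePath n) → Symmetric p → Symmetric q → p ≼ q →
    ConvHullDim (FeasibleVector p q) (suc n ∸ commonAbove p q)
proposition4p5 n p q p-symmetric q-symmetric p≼q =
  subst (ConvHullDim (FeasibleVector p q)) (#loose≡suc-n∸commonAbove p q) (independentFamily , noLargerFamily)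
  where
  P⊑Q = ≼⇒⊑-half p q p≼q
  independentFamily : ∃ λ (vs : Fin (suc (#loose (half p) (half q))) → Fin n → ℚ) →
    (∀ i → FeasibleVector p q (vs i)) × AffinelyIndependent vs
  independentFamily with independent-words (half p) (half q) P⊑Q (#E (half p)) ℕₚ.≤-refl (P⊑Q 0)
  ... | F , between , independent , _ =
    (λ i → eVector (F i)) , (λ i → feasible-eVector p q p-symmetric q-symmetric (between i)) ,
    independent⇒affinelyIndependent (eVector ∘ F) independent
  noLargerFamily : (vs : Fin (suc (suc (#loose (half p) (half q)))) → Fin n → ℚ) →
    (∀ i → FeasibleVector p q (vs i)) → ¬ AffinelyIndependent vs
  noLargerFamily vs feasible = dependent⇒¬affinelyIndependent (dependent-≗ vs≗eVector
    (tight-rank (half p) (half q) (λ _ → 1ℚ) (λ i → eVector (W i))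
                (λ i → between⇒tight (proj₁ (proj₂ (witness i))))))
    where
    witness = λ i → feasible⇒between p q (feasible i)
    W = λ i → proj₁ (witness i)
    vs≗eVector = λ i → proj₂ (proj₂ (witness i))
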